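{- Consider an instance of \textsf{Dynamic $k$-Supplier} with $T=2$ and optimal value $R^*$, and the flow network $\mathcal{G}$ constructed from it as described in the context. Then $\mathcal{G}$ admits an $\mathsf{s}$-$\mathsf{t}$ flow of value $k$. Moreover, from any integral $\mathsf{s}$-$\mathsf{t}$ flow of value $k$ in $\mathcal{G}$ one can obtain a feasible solution of the instance with objective value at most $3R^*$.
   Context: Let $(X,d)$ be a finite metric space and $d(j,A)=\min_{i\in A}d(i,j)$. An instance of \textsf{Dynamic $k$-Supplier} with $T=2$ consists of client sets $C_1,C_2\subset X$, candidate facility location sets $F_1,F_2\subset X$, a movement bound $B>0$ and an integer $k\geq 1$. A feasible solution is a pair of multi-sets $A_1\subset F_1$, $A_2\subset F_2$ (repetitions allowed) with $|A_1|=|A_2|=k$ such that there is a one-to-one matching between $A_1$ and $A_2$ in which every matched pair $(i,i')$ has $d(i,i')\leq B$; its objective is $\max_{t\in\{1,2\}}\max_{j\in C_t}d(j,A_t)$, and $R^*$ is the minimum objective over feasible solutions. Construction of $\mathcal{G}$: For $t\in\{1,2\}$, form clusters of $C_t$ by repeatedly picking an arbitrary remaining client $j\in C_t$ (the cluster's center) and removing from $C_t$ every remaining client within distance $2R^*$ of $j$ (these form the cluster of $j$); this yields at most $k$ clusters, and dummy clusters (corresponding to no client) are added so that there are exactly $k$ clusters for each $t$. The network has a source $\mathsf{s}$, a sink $\mathsf{t}$ and four layers: $\mathcal{L}^{11}$ with one vertex per cluster of $C_1$, $\mathcal{L}^{12}$ with one vertex per $i\in F_1$, $\mathcal{L}^{21}$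 with one vertex per $i'\in F_2$, and $\mathcal{L}^{22}$ with one vertex per cluster of $C_2$. Arcs: from $\mathsf{s}$ to each vertex of $\mathcal{L}^{11}$ with capacity $1$; from a non-dummy cluster $u\in\mathcal{L}^{11}$ with center $j$ to $i\in\mathcal{L}^{12}$ with capacity $1$ whenever $d(j,i)\leq R^*$; from each dummy cluster in $\mathcal{L}^{11}$ to every vertex of $\mathcal{L}^{12}$ with capacity $1$; from $i\in\mathcal{L}^{12}$ to $i'\in\mathcal{L}^{21}$ with unbounded capacity whenever $d(i,i')\leq B$; from $i'\in\mathcal{L}^{21}$ to a non-dummy cluster of $C_2$ with center $j$ with capacity $1$ whenever $d(i',j)\leq R^*$; from every vertex of $\mathcal{L}^{21}$ to each dummy cluster of $\mathcal{L}^{22}$ with capacity $1$; from each vertex of $\mathcal{L}^{22}$ to $\mathsf{t}$ with capacity $1$.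
   Formalization: The metric $d$, the movement bound $B$ and the optimal value $R^*$ take rational values. -}

module Defs where

open import Data.Bool using (Bool; true; false; _∧_; not; if_then_else_)
open import Data.Nat using (ℕ; _∸_)
open import Data.Integer using (+_)
open import Data.Fin using (Fin)
import Data.Fin.Properties as FinP
open import Data.Fin.Subset using (Subset; _∈_; Empty; _─_)
open import Data.Fin.Subset.Properties using (_∈?_)
open import Data.Vec using (tabulate)
open import Data.List using (List; []; _∷_; length; lookup; map; _++_; foldr; allFin; filterᵇ)
open import Data.Product using (_×_; _,_; proj₁; proj₂; ∃)
open import Data.Unit using (⊤)
open import Relation.Nullary using (does; ¬_)
open import Relation.Binary.PropositionalEquality using (_≡_; _≢_)
open import Data.Rational using (ℚ; 0ℚ; 1ℚ; _≤_; _<_; _+_; _-_; _/_; _≤ᵇ_)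

ℕtoℚ : ℕ → ℚ
ℕtoℚ m = (+ m) / 1

sumℚ : List ℚ → ℚ
sumℚ = foldr _+_ 0ℚ

countᵇ : (k : ℕ) → (Fin k → Bool) → ℕ
countᵇ k p = length (filterᵇ p (allFin k))

record IsMetric {n : ℕ} (d : Fin n → Fin n → ℚ) : Set where
  field
    nonneg   : ∀ x y → 0ℚ ≤ d x y
    zero⇒eq  : ∀ x y → d x y ≡ 0ℚ → x ≡ y
    eq⇒zero  : ∀ x → d x x ≡ 0ℚ
    symm     : ∀ x y → d x y ≡ d y x
    triangle : ∀ x y z → d x z ≤ d x y + d y z

-- Dynamic k-Supplier with T = 2.
-- A solution: k matched pairs (i , i'); the multiset of first components is
-- A₁, the multiset of second components is A₂, and the pairs are the
-- one-to-one matching between A₁ and A₂.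

Solution : ℕ → ℕ → Set
Solution n k = Fin k → Fin n × Fin n

module _ {n : ℕ} (d : Fin n → Fin n → ℚ) where

  Feasible : (F₁ F₂ : Subset n) (B : ℚ) {k : ℕ} → Solution n k → Set
  Feasible F₁ F₂ B sol =
    ∀ l → (proj₁ (sol l) ∈ F₁) × (proj₂ (sol l) ∈ F₂) × (d (proj₁ (sol l)) (proj₂ (sol l)) ≤ B)

  -- "the objective value of sol is at most r"
  -- (objective = max_t max_{j ∈ C_t} d(j, A_t), a nonnegative quantity)
  CostAtMost : (C₁ C₂ : Subset n) {k : ℕ} → Solution n k → ℚ → Set
  CostAtMost C₁ C₂ sol r =
    (0ℚ ≤ r)
    × (∀ j → j ∈ C₁ → ∃ λ l → d j (proj₁ (sol l)) ≤ r)
    × (∀ j → j ∈ C₂ → ∃ λ l → d j (proj₂ (sol l)) ≤ r)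

  OptimalValue : (C₁ C₂ F₁ F₂ : Subset n) (B : ℚ) (k : ℕ) (R : ℚ) → Set
  OptimalValue C₁ C₂ F₁ F₂ B k R =
    (∃ λ (sol : Solution n k) → Feasible F₁ F₂ B sol × CostAtMost C₁ C₂ sol R)
    × (∀ (sol : Solution n k) r → Feasible F₁ F₂ B sol → CostAtMost C₁ C₂ sol r → R ≤ r)

  -- Greedy clustering with radius 2R: Greedy R rem cs  means that running
  -- the procedure on the remaining clients rem may output the list of
  -- cluster centers cs (in the order they were picked).

  ball : ℚ → Fin n → Subset n
  ball ρ j = tabulate (λ x → d j x ≤ᵇ ρ)

  data Greedy (R : ℚ) : Subset n → List (Fin n) → Set where
    done : ∀ {rem} → Empty rem → Greedy R rem []
    pick : ∀ {rem j cs} → j ∈ rem → Greedy R (rem ─ ball (R + R) j) cs → Greedy R rem (j ∷ cs)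

  data Cap : Set where
    none one ∞ : Cap

  module Network (F₁ F₂ : Subset n) (B R : ℚ) (k : ℕ) (cs₁ cs₂ : List (Fin n)) where

    data Vtx : Set where
      src snk : Vtx
      cl₁ : Fin (length cs₁) → Vtx
      dm₁ : Fin (k ∸ length cs₁) → Vtx
      fa₁ : Fin n → Vtx                     -- L¹² (only i ∈ F₁ carry arcs)
      fa₂ : Fin n → Vtx                     -- L²¹ (only i' ∈ F₂ carry arcs)
      cl₂ : Fin (length cs₂) → Vtx
      dm₂ : Fin (k ∸ length cs₂) → Vtx

    allV : List Vtx
    allV = src ∷ snk ∷ map cl₁ (allFin _) ++ map dm₁ (allFin _) ++ map fa₁ (allFin _)
             ++ map fa₂ (allFin _) ++ map cl₂ (allFin _) ++ map dm₂ (allFin _)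

    inF₁ inF₂ : Fin n → Bool
    inF₁ i = does (i ∈? F₁)
    inF₂ i = does (i ∈? F₂)

    arcIf : Bool → Cap → Cap
    arcIf b c = if b then c else none

    cap : Vtx → Vtx → Cap
    cap src (cl₁ _) = one
    cap src (dm₁ _) = one
    cap (cl₁ u) (fa₁ i) = arcIf (inF₁ i ∧ (d (lookup cs₁ u) i ≤ᵇ R)) one
    cap (dm₁ _) (fa₁ i) = arcIf (inF₁ i) one
    cap (fa₁ i) (fa₂ i') = arcIf (inF₁ i ∧ inF₂ i' ∧ (d i i' ≤ᵇ B)) ∞
    cap (fa₂ i') (cl₂ u) = arcIf (inF₂ i' ∧ (d i' (lookup cs₂ u) ≤ᵇ R)) one
    cap (fa₂ i') (dm₂ _) = arcIf (inF₂ i') one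
    cap (cl₂ _) snk = one
    cap (dm₂ _) snk = one
    cap _ _ = none

    Within : Cap → ℚ → Set
    Within none q = q ≡ 0ℚ
    Within one  q = q ≤ 1ℚ
    Within ∞    q = ⊤

    inflow outflow : (Vtx → Vtx → ℚ) → Vtx → ℚ
    inflow  f v = sumℚ (map (λ u → f u v) allV)
    outflow f v = sumℚ (map (λ w → f v w) allV)

    record IsFlow (f : Vtx → Vtx → ℚ) : Set where
      field
        nonneg       : ∀ u v → 0ℚ ≤ f u v
        capacity     : ∀ u v → Within (cap u v) (f u v)
        conservation : ∀ v → v ≢ src → v ≢ snk → inflow f v ≡ outflow f v

    value : (Vtx → Vtx → ℚ) → ℚ
    value f = outflow f src - inflow f src

    Integral : (Vtx → Vtx → ℚ) → Set
    Integral f = ∀ u v → ∃ λ (m : ℕ) → f u v ≡ ℕtoℚ m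

    -- sol is read off from f: for all i, i' the number of matched pairs
    -- (i , i') equals the flow on the arc from i ∈ L¹² to i' ∈ L²¹
    -- (so A₁, A₂ are the facilities carrying flow, with multiplicity).
    ObtainedFrom : (Vtx → Vtx → ℚ) → Solution n k → Set
    ObtainedFrom f sol =
      ∀ i i' → f (fa₁ i) (fa₂ i')
        ≡ ℕtoℚ (countᵇ k (λ l → does (proj₁ (sol l) FinP.≟ i) ∧ does (proj₂ (sol l) FinP.≟ i')))

{-# OPTIONS --safe #-}

-- A greedy centre is a client, so some pair (i, i′) of an optimal solution has its facility on that
-- side within R* of it; centres are more than 2R* apart, so distinct centres are served by distinct
-- pairs. Matching the dummy clusters with the unserved pairs and sending one unit along
-- s → cluster → i → i′ → cluster → t for every optimal pair gives a flow of value k.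
-- Conversely, an integral flow of value k saturates the k unit arcs leaving s and the k entering t.
-- Hence every centre sends flow to a facility i within R* that forwards it to some i′, and listing
-- each middle arc (i, i′) as often as the flow on it gives k pairs (the flow across the middle layer
-- is k), each with d(i, i′) ≤ B. Every client lies within 2R* of a centre, hence within 3R* of a
-- chosen facility.

module Submission where

open import Defs
open import Data.Bool using (Bool; true; false; _∧_; T)
open import Data.Bool.Properties using (T-≡; T-∧)
open import Data.Empty using (⊥-elim)
open import Data.Fin using (Fin; zero; suc)
open import Data.Fin.Properties using (_≟_; any?; injective⇒≤)
open import Data.Fin.Subset using (Subset; _∈_; _∉_; _─_; inside)
open import Data.Fin.Subset.Properties using (_∈?_; x∈p∧x∉q⇒x∈p─q; p─q⊆p)
import Data.Integer as ℤ
import Data.Integer.Properties as ℤ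
open import Data.List
  using (List; []; _∷_; map; allFin; tabulate; length; lookup; filter; filterᵇ; concat; replicate; _++_)
import Data.List.Properties as List
open import Data.List.Membership.Propositional using () renaming (_∈_ to _∈ₗ_)
open import Data.List.Membership.Propositional.Properties
  using (∈-tabulate⁺; ∈-tabulate⁻; ∈-filter⁺; ∈-filter⁻; ∈-++⁺ˡ; ∈-++⁺ʳ; ∈-allFin)
open import Data.List.Membership.Propositional.Properties.WithK using (unique∧set⇒bag)
open import Data.List.Relation.Binary.BagAndSetEquality using (∼bag⇒↭)
open import Data.List.Relation.Binary.Disjoint.Propositional using (Disjoint)
open import Data.List.Relation.Binary.Permutation.Propositional using (_↭_)
import Data.List.Relation.Binary.Permutation.Propositional.Properties as ↭
open import Data.List.Relation.Unary.Unique.Propositional using (Unique)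
open import Data.List.Relation.Unary.Unique.Propositional.Properties using (++⁺; tabulate⁺; filter⁺; allFin⁺)
open import Data.Nat as ℕ using (ℕ; zero; suc; _∸_; _+_; _*_; _≤_; _<_; z≤n; s≤s)
open import Data.Nat.Coprimality using (1-coprimeTo)
import Data.Nat.Coprimality as Coprime
open import Data.Nat.ListAction using (sum)
open import Data.Nat.ListAction.Properties using (sum-++; sum-↭)
import Data.Nat.Properties as ℕ
open import Algebra.Properties.Semiring.Sum ℕ.+-*-semiring
  using (sum-syntax; sum-cong-≗; ∑-distrib-+; ∑-comm; *-distribˡ-sum; *-distribʳ-sum)
open import Data.Product using (∃; _×_; _,_; proj₁; proj₂)
open import Data.Rational as ℚ using (ℚ; 0ℚ; _≤ᵇ_)
import Data.Rational.Properties as ℚ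
open import Data.Unit using (⊤; tt)
open import Data.Vec using (_∷_; here; there)
import Data.Vec.Properties as Vec
open import Function using (_∘_; Injective; Equivalence; mk⇔)
open import Relation.Nullary using (Dec; does; yes; no; ¬_; ¬?)
open import Relation.Binary.PropositionalEquality

-- ℕtoℚ m normalises m / 1 by a gcd computation, which does not reduce for a variable m.
ℕtoℚ≡mkℚ : ∀ m → ℕtoℚ m ≡ ℚ.mkℚ (ℤ.+ m) 0 (Coprime.sym (1-coprimeTo m))
ℕtoℚ≡mkℚ m = ℚ.normalize-coprime (Coprime.sym (1-coprimeTo m))

ℕtoℚ-+ : ∀ a b → ℕtoℚ (a + b) ≡ ℕtoℚ a ℚ.+ ℕtoℚ b
ℕtoℚ-+ a b = begin
  ℕtoℚ (a + b)
    ≡⟨ cong (ℚ._/ 1) (cong₂ ℤ._+_ (ℤ.*-identityʳ (ℤ.+ a)) (ℤ.*-identityʳ (ℤ.+ b))) ⟨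
  (ℤ.+ a ℤ.* ℤ.+ 1 ℤ.+ ℤ.+ b ℤ.* ℤ.+ 1) ℚ./ 1
    ≡⟨ cong₂ ℚ._+_ (ℕtoℚ≡mkℚ a) (ℕtoℚ≡mkℚ b) ⟨
  ℕtoℚ a ℚ.+ ℕtoℚ b ∎
  where open ≡-Reasoning

ℕtoℚ-mono-≤ : ∀ {a b} → a ≤ b → ℕtoℚ a ℚ.≤ ℕtoℚ b
ℕtoℚ-mono-≤ {a} {b} a≤b rewrite ℕtoℚ≡mkℚ a | ℕtoℚ≡mkℚ b =
  ℚ.*≤* (subst₂ ℤ._≤_ (sym (ℤ.*-identityʳ (ℤ.+ a))) (sym (ℤ.*-identityʳ (ℤ.+ b))) (ℤ.+≤+ a≤b))

ℕtoℚ-cancel-≤ : ∀ {a b} → ℕtoℚ a ℚ.≤ ℕtoℚ b → a ≤ b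
ℕtoℚ-cancel-≤ {a} {b} p rewrite ℕtoℚ≡mkℚ a | ℕtoℚ≡mkℚ b =
  ℤ.drop‿+≤+ (subst₂ ℤ._≤_ (ℤ.*-identityʳ (ℤ.+ a)) (ℤ.*-identityʳ (ℤ.+ b)) (ℚ.drop-*≤* p))

ℕtoℚ-injective : ∀ {a b} → ℕtoℚ a ≡ ℕtoℚ b → a ≡ b
ℕtoℚ-injective p = ℕ.≤-antisym (ℕtoℚ-cancel-≤ (ℚ.≤-reflexive p)) (ℕtoℚ-cancel-≤ (ℚ.≤-reflexive (sym p)))

sumℚ-map-ℕtoℚ : ∀ {A : Set} (h : A → ℕ) xs → sumℚ (map (ℕtoℚ ∘ h) xs) ≡ ℕtoℚ (sum (map h xs))
sumℚ-map-ℕtoℚ h []       = refl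
sumℚ-map-ℕtoℚ h (x ∷ xs) = trans (cong (ℕtoℚ (h x) ℚ.+_) (sumℚ-map-ℕtoℚ h xs)) (sym (ℕtoℚ-+ (h x) _))

T-does⁺ : ∀ {A : Set} (a? : Dec A) → A → T (does a?)
T-does⁺ (yes _) _ = tt
T-does⁺ (no ¬a) a = ¬a a

T-does⁻ : ∀ {A : Set} (a? : Dec A) → T (does a?) → A
T-does⁻ (yes a) _ = a

fromBool : Bool → ℕ
fromBool true  = 1
fromBool false = 0

fromBool-∧ : ∀ a b → fromBool (a ∧ b) ≡ fromBool a * fromBool b
fromBool-∧ true  b = sym (ℕ.+-identityʳ (fromBool b))
fromBool-∧ false b = refl

δ : ∀ {n} → Fin n → Fin n → ℕ
δ x y = fromBool (does (x ≟ y))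

δ-refl : ∀ {n} (x : Fin n) → δ x x ≡ 1
δ-refl x with x ≟ x
... | yes _  = refl
... | no x≢x = ⊥-elim (x≢x refl)

δ-≢ : ∀ {n} {x y : Fin n} → x ≢ y → δ x y ≡ 0
δ-≢ {x = x} {y} x≢y with x ≟ y
... | yes x≡y = ⊥-elim (x≢y x≡y)
... | no _    = refl

δ-sym : ∀ {n} (x y : Fin n) → δ x y ≡ δ y x
δ-sym x y with y ≟ x
... | yes refl = δ-refl x
... | no y≢x   = δ-≢ (y≢x ∘ sym)

δ-≤1 : ∀ {n} (x y : Fin n) → δ x y ≤ 1
δ-≤1 x y with x ≟ y
... | yes _ = ℕ.≤-refl
... | no _  = z≤n

δ² : ∀ {n} → Fin n × Fin n → Fin n × Fin n → ℕ
δ² (a , b) (i , j) = δ a i * δ b j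

δ²-pos⇒≡ : ∀ {n} (p q : Fin n × Fin n) → 0 < δ² p q → p ≡ q
δ²-pos⇒≡ (a , b) (i , j) pos with a ≟ i | b ≟ j
... | yes refl | yes refl = refl
... | yes _    | no _     = ⊥-elim (ℕ.<-irrefl refl pos)
... | no _     | _        = ⊥-elim (ℕ.<-irrefl refl pos)

δ²-refl : ∀ {n} (p : Fin n × Fin n) → δ² p p ≡ 1
δ²-refl (a , b) = cong₂ _*_ (δ-refl a) (δ-refl b)

sum-tabulate : ∀ {n} (f : Fin n → ℕ) → sum (tabulate f) ≡ ∑[ x < n ] f x
sum-tabulate {zero}  f = refl
sum-tabulate {suc n} f = cong (f zero +_) (sum-tabulate (f ∘ suc))

sum-map-allFin : ∀ {n} (f : Fin n → ℕ) → sum (map f (allFin n)) ≡ ∑[ x < n ] f x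
sum-map-allFin f = trans (cong sum (List.map-tabulate (λ x → x) f)) (sum-tabulate f)

∑-zero : ∀ {n} {f : Fin n → ℕ} → (∀ x → f x ≡ 0) → ∑[ x < n ] f x ≡ 0
∑-zero {zero}  f≡0 = refl
∑-zero {suc n} f≡0 = cong₂ _+_ (f≡0 zero) (∑-zero (f≡0 ∘ suc))

∑-δ : ∀ {n} (f : Fin n → ℕ) (x : Fin n) → ∑[ y < n ] (f y * δ y x) ≡ f x
∑-δ {suc n} f zero    = begin
  f zero * 1 + ∑[ y < n ] (f (suc y) * 0)  ≡⟨ cong₂ _+_ (ℕ.*-identityʳ (f zero)) (∑-zero (ℕ.*-zeroʳ ∘ f ∘ suc)) ⟩
  f zero + 0                               ≡⟨ ℕ.+-identityʳ (f zero) ⟩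
  f zero                                   ∎
  where open ≡-Reasoning
∑-δ {suc n} f (suc x) = trans (cong (_+ ∑[ y < n ] (f (suc y) * δ y x)) (ℕ.*-zeroʳ (f zero))) (∑-δ (f ∘ suc) x)

∑-δ-one : ∀ {n} (x : Fin n) → ∑[ y < n ] δ x y ≡ 1
∑-δ-one x = trans (sum-cong-≗ (λ y → trans (δ-sym x y) (sym (ℕ.*-identityˡ (δ y x))))) (∑-δ (λ _ → 1) x)

∑-one : ∀ n → ∑[ x < n ] 1 ≡ n
∑-one zero    = refl
∑-one (suc n) = cong suc (∑-one n)

∑-term : ∀ {n} (f : Fin n → ℕ) x → f x ≤ ∑[ y < n ] f y
∑-term f zero    = ℕ.m≤m+n (f zero) _
∑-term f (suc x) = ℕ.≤-trans (∑-term (f ∘ suc) x) (ℕ.m≤n+m _ (f zero))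

∑-pos : ∀ {n} (f : Fin n → ℕ) → 0 < ∑[ x < n ] f x → ∃ λ x → 0 < f x
∑-pos {suc n} f p with f zero in f₀
... | suc _ = zero , subst (0 <_) (sym f₀) (s≤s z≤n)
... | zero  with ∑-pos (f ∘ suc) p
...   | x , q = suc x , q

∑-≤-bound : ∀ {n} (f : Fin n → ℕ) → (∀ x → f x ≤ 1) → ∑[ x < n ] f x ≤ n
∑-≤-bound {zero}  f f≤1 = z≤n
∑-≤-bound {suc n} f f≤1 = ℕ.+-mono-≤ (f≤1 zero) (∑-≤-bound (f ∘ suc) (f≤1 ∘ suc))

∑≡bound⇒all≡1 : ∀ {n} (f : Fin n → ℕ) → (∀ x → f x ≤ 1) → ∑[ x < n ] f x ≡ n → ∀ x → f x ≡ 1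
∑≡bound⇒all≡1 {suc n} f f≤1 ∑≡1+n = λ where
    zero    → f₀≡1
    (suc x) → ∑≡bound⇒all≡1 (f ∘ suc) (f≤1 ∘ suc) rest≡n x
  where
  rest = ∑[ x < n ] f (suc x)
  f₀≡1 : f zero ≡ 1
  f₀≡1 = ℕ.≤-antisym (f≤1 zero) (ℕ.+-cancelʳ-≤ n 1 (f zero) (begin
    1 + n         ≡⟨ ∑≡1+n ⟨
    f zero + rest ≤⟨ ℕ.+-monoʳ-≤ (f zero) (∑-≤-bound (f ∘ suc) (f≤1 ∘ suc)) ⟩
    f zero + n    ∎))
    where open ℕ.≤-Reasoning
  rest≡n : rest ≡ n
  rest≡n = ℕ.+-cancelˡ-≡ 1 rest n (trans (cong (_+ rest) (sym f₀≡1)) ∑≡1+n)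

length-filterᵇ : ∀ {A : Set} (p : A → Bool) xs → length (filterᵇ p xs) ≡ sum (map (fromBool ∘ p) xs)
length-filterᵇ p []       = refl
length-filterᵇ p (x ∷ xs) with p x
... | true  = cong suc (length-filterᵇ p xs)
... | false = length-filterᵇ p xs

countᵇ-∑ : ∀ k (p : Fin k → Bool) → countᵇ k p ≡ ∑[ l < k ] fromBool (p l)
countᵇ-∑ k p = trans (length-filterᵇ p (allFin k)) (sum-map-allFin (fromBool ∘ p))

enumerate : ∀ {A : Set} {n} (xs : List A) → length xs ≡ n → Fin n → A
enumerate xs refl = lookup xs

∑-enumerate : ∀ {A : Set} {n} (xs : List A) (e : length xs ≡ n) (h : A → ℕ) →
              ∑[ x < n ] h (enumerate xs e x) ≡ sum (map h xs)
∑-enumerate xs refl h = begin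
  ∑[ x < length xs ] h (lookup xs x)  ≡⟨ sum-tabulate (h ∘ lookup xs) ⟨
  sum (tabulate (h ∘ lookup xs))      ≡⟨ cong sum (List.map-tabulate (lookup xs) h) ⟨
  sum (map h (tabulate (lookup xs)))  ≡⟨ cong (sum ∘ map h) (List.tabulate-lookup xs) ⟩
  sum (map h xs)                      ∎
  where open ≡-Reasoning

∑-saturated : ∀ {m m′} (f : Fin m → ℕ) (f′ : Fin m′ → ℕ) → (∀ x → f x ≤ 1) → (∀ y → f′ y ≤ 1) →
              ∑[ x < m ] f x + ∑[ y < m′ ] f′ y ≡ m + m′ → ∀ x → f x ≡ 1
∑-saturated {m} {m′} f f′ f≤1 f′≤1 total = ∑≡bound⇒all≡1 f f≤1 (ℕ.≤-antisym ∑f≤m m≤∑f)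
  where
  ∑f≤m = ∑-≤-bound f f≤1
  m≤∑f : m ≤ ∑[ x < m ] f x
  m≤∑f = ℕ.+-cancelʳ-≤ m′ m (∑[ x < m ] f x) (begin
    m + m′                               ≡⟨ total ⟨
    ∑[ x < m ] f x + ∑[ y < m′ ] f′ y   ≤⟨ ℕ.+-monoʳ-≤ (∑[ x < m ] f x) (∑-≤-bound f′ f′≤1) ⟩
    ∑[ x < m ] f x + m′                  ∎)
    where open ℕ.≤-Reasoning

module _ {n k} (p : Fin k → Fin n × Fin n) where

  marginal₁ : ∀ i → ∑[ j < n ] ∑[ l < k ] δ² (p l) (i , j) ≡ ∑[ l < k ] δ (proj₁ (p l)) i
  marginal₁ i = trans (∑-comm (λ j l → δ² (p l) (i , j))) (sum-cong-≗ λ l → begin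
    ∑[ j < n ] (δ (proj₁ (p l)) i * δ (proj₂ (p l)) j)  ≡⟨ *-distribˡ-sum (δ (proj₁ (p l)) i) (δ (proj₂ (p l))) ⟨
    δ (proj₁ (p l)) i * ∑[ j < n ] δ (proj₂ (p l)) j    ≡⟨ cong (δ (proj₁ (p l)) i *_) (∑-δ-one (proj₂ (p l))) ⟩
    δ (proj₁ (p l)) i * 1                               ≡⟨ ℕ.*-identityʳ _ ⟩
    δ (proj₁ (p l)) i                                   ∎)
    where open ≡-Reasoning

  marginal₂ : ∀ j → ∑[ i < n ] ∑[ l < k ] δ² (p l) (i , j) ≡ ∑[ l < k ] δ (proj₂ (p l)) j
  marginal₂ j = trans (∑-comm (λ i l → δ² (p l) (i , j))) (sum-cong-≗ λ l → begin
    ∑[ i < n ] (δ (proj₁ (p l)) i * δ (proj₂ (p l)) j)  ≡⟨ *-distribʳ-sum (δ (proj₂ (p l)) j) (δ (proj₁ (p l))) ⟨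
    ∑[ i < n ] δ (proj₁ (p l)) i * δ (proj₂ (p l)) j    ≡⟨ cong (_* δ (proj₂ (p l)) j) (∑-δ-one (proj₁ (p l))) ⟩
    1 * δ (proj₂ (p l)) j                               ≡⟨ ℕ.*-identityˡ _ ⟩
    δ (proj₂ (p l)) j                                   ∎)
    where open ≡-Reasoning

module _ {m k} (φ : Fin m → Fin k) (φ-injective : Injective _≡_ _≡_ φ) where

  inImage? : ∀ l → Dec (∃ λ u → φ u ≡ l)
  inImage? l = any? (λ u → φ u ≟ l)

  missed : List (Fin k)
  missed = filter (¬? ∘ inImage?) (allFin k)

  image++missed↭allFin : tabulate φ ++ missed ↭ allFin k
  image++missed↭allFin = ∼bag⇒↭ (unique∧set⇒bag unique (allFin⁺ k) (mk⇔ (λ _ → ∈-allFin _) covered))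
    where
    disjoint : Disjoint (tabulate φ) missed
    disjoint (l∈image , l∈missed) with ∈-tabulate⁻ l∈image
    ... | u , refl = proj₂ (∈-filter⁻ (¬? ∘ inImage?) {xs = allFin k} l∈missed) (u , refl)
    unique : Unique (tabulate φ ++ missed)
    unique = ++⁺ (tabulate⁺ φ-injective) (filter⁺ (¬? ∘ inImage?) (allFin⁺ k)) disjoint
    covered : ∀ {l} → l ∈ₗ allFin k → l ∈ₗ tabulate φ ++ missed
    covered {l} _ with inImage? l
    ... | yes (u , refl) = ∈-++⁺ˡ (∈-tabulate⁺ u)
    ... | no l∉image     = ∈-++⁺ʳ (tabulate φ) (∈-filter⁺ (¬? ∘ inImage?) (∈-allFin l) l∉image)

  length-missed : length missed ≡ k ∸ m
  length-missed = begin
    length missed                            ≡⟨ ℕ.m+n∸m≡n m (length missed) ⟨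
    m + length missed ∸ m                    ≡⟨ cong (λ a → a + length missed ∸ m) (List.length-tabulate φ) ⟨
    length (tabulate φ) + length missed ∸ m  ≡⟨ cong (_∸ m) (List.length-++ (tabulate φ)) ⟨
    length (tabulate φ ++ missed) ∸ m        ≡⟨ cong (_∸ m) (↭.↭-length image++missed↭allFin) ⟩
    length (allFin k) ∸ m                    ≡⟨ cong (_∸ m) (List.length-tabulate (λ l → l)) ⟩
    k ∸ m                                    ∎
    where open ≡-Reasoning

  complement : Fin (k ∸ m) → Fin k
  complement = enumerate missed length-missed

  ∑-image+complement : ∀ (h : Fin k → ℕ) → ∑[ u < m ] h (φ u) + ∑[ a < k ∸ m ] h (complement a) ≡ ∑[ l < k ] h l
  ∑-image+complement h = begin
    ∑[ u < m ] h (φ u) + ∑[ a < k ∸ m ] h (complement a)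
      ≡⟨ cong₂ _+_ (sum-tabulate (h ∘ φ)) (sym (∑-enumerate missed length-missed h)) ⟨
    sum (tabulate (h ∘ φ)) + sum (map h missed)
      ≡⟨ cong (_+ sum (map h missed)) (cong sum (List.map-tabulate φ h)) ⟨
    sum (map h (tabulate φ)) + sum (map h missed)
      ≡⟨ sum-++ (map h (tabulate φ)) (map h missed) ⟨
    sum (map h (tabulate φ) ++ map h missed)
      ≡⟨ cong sum (List.map-++ h (tabulate φ) missed) ⟨
    sum (map h (tabulate φ ++ missed))
      ≡⟨ sum-↭ (↭.map⁺ h image++missed↭allFin) ⟩
    sum (map h (allFin k))
      ≡⟨ sum-map-allFin h ⟩
    ∑[ l < k ] h l ∎
    where open ≡-Reasoning

sum-map-replicate : ∀ {A : Set} c (x : A) (q : A → ℕ) → sum (map q (replicate c x)) ≡ c * q x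
sum-map-replicate zero    x q = refl
sum-map-replicate (suc c) x q = cong (q x +_) (sum-map-replicate c x q)

sum-map-concat-tabulate : ∀ {A : Set} {n} (F : Fin n → List A) (q : A → ℕ) →
                          sum (map q (concat (tabulate F))) ≡ ∑[ a < n ] sum (map q (F a))
sum-map-concat-tabulate {n = zero}  F q = refl
sum-map-concat-tabulate {n = suc n} F q = begin
  sum (map q (F zero ++ concat (tabulate (F ∘ suc))))
    ≡⟨ cong sum (List.map-++ q (F zero) _) ⟩
  sum (map q (F zero) ++ map q (concat (tabulate (F ∘ suc))))
    ≡⟨ sum-++ (map q (F zero)) _ ⟩
  sum (map q (F zero)) + sum (map q (concat (tabulate (F ∘ suc))))
    ≡⟨ cong (sum (map q (F zero)) +_) (sum-map-concat-tabulate (F ∘ suc) q) ⟩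
  sum (map q (F zero)) + ∑[ a < n ] sum (map q (F (suc a))) ∎
  where open ≡-Reasoning

length≡sum-map-1 : ∀ {A : Set} (xs : List A) → length xs ≡ sum (map (λ _ → 1) xs)
length≡sum-map-1 []       = refl
length≡sum-map-1 (x ∷ xs) = cong suc (length≡sum-map-1 xs)

module _ {n k} (M : Fin n → Fin n → ℕ) (total : ∑[ i < n ] ∑[ j < n ] M i j ≡ k) where

  withMultiplicity : List (Fin n × Fin n)
  withMultiplicity = concat (tabulate λ i → concat (tabulate λ j → replicate (M i j) (i , j)))

  sum-map-withMultiplicity : ∀ q → sum (map q withMultiplicity) ≡ ∑[ i < n ] ∑[ j < n ] (M i j * q (i , j))
  sum-map-withMultiplicity q =
    trans (sum-map-concat-tabulate (λ i → concat (tabulate λ j → replicate (M i j) (i , j))) q) (sum-cong-≗ λ i →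
      trans (sum-map-concat-tabulate (λ j → replicate (M i j) (i , j)) q)
        (sum-cong-≗ λ j → sum-map-replicate (M i j) (i , j) q))

  length-withMultiplicity : length withMultiplicity ≡ k
  length-withMultiplicity = begin
    length withMultiplicity                    ≡⟨ length≡sum-map-1 withMultiplicity ⟩
    sum (map (λ _ → 1) withMultiplicity)       ≡⟨ sum-map-withMultiplicity (λ _ → 1) ⟩
    ∑[ i < n ] ∑[ j < n ] (M i j * 1)          ≡⟨ sum-cong-≗ (λ i → sum-cong-≗ (λ j → ℕ.*-identityʳ (M i j))) ⟩
    ∑[ i < n ] ∑[ j < n ] M i j                ≡⟨ total ⟩
    k                                          ∎
    where open ≡-Reasoning

  realise : Fin k → Fin n × Fin n
  realise = enumerate withMultiplicity length-withMultiplicity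

  ∑-δ²-realise : ∀ p → ∑[ l < k ] δ² (realise l) p ≡ M (proj₁ p) (proj₂ p)
  ∑-δ²-realise (i , j) = begin
    ∑[ l < k ] δ² (realise l) (i , j)                  ≡⟨ ∑-enumerate withMultiplicity length-withMultiplicity _ ⟩
    sum (map (λ p → δ² p (i , j)) withMultiplicity)    ≡⟨ sum-map-withMultiplicity _ ⟩
    ∑[ a < n ] ∑[ b < n ] (M a b * (δ a i * δ b j))    ≡⟨ sum-cong-≗ (λ a → sum-cong-≗ λ b → ℕ.*-assoc (M a b) _ _) ⟨
    ∑[ a < n ] ∑[ b < n ] (M a b * δ a i * δ b j)      ≡⟨ sum-cong-≗ (λ a → ∑-δ (λ b → M a b * δ a i) j) ⟩
    ∑[ a < n ] (M a j * δ a i)                         ≡⟨ ∑-δ (λ a → M a j) i ⟩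
    M i j                                              ∎
    where open ≡-Reasoning

  countᵇ-realise : ∀ i j → countᵇ k (λ l → does (proj₁ (realise l) ≟ i) ∧ does (proj₂ (realise l) ≟ j)) ≡ M i j
  countᵇ-realise i j = begin
    countᵇ k (λ l → does (proj₁ (realise l) ≟ i) ∧ does (proj₂ (realise l) ≟ j))
      ≡⟨ countᵇ-∑ k _ ⟩
    ∑[ l < k ] fromBool (does (proj₁ (realise l) ≟ i) ∧ does (proj₂ (realise l) ≟ j))
      ≡⟨ sum-cong-≗ (λ l → fromBool-∧ (does (proj₁ (realise l) ≟ i)) _) ⟩
    ∑[ l < k ] δ² (realise l) (i , j)
      ≡⟨ ∑-δ²-realise (i , j) ⟩
    M i j ∎
    where open ≡-Reasoning

  realise-hits : ∀ i j → 0 < M i j → ∃ λ l → realise l ≡ (i , j)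
  realise-hits i j pos with ∑-pos (λ l → δ² (realise l) (i , j)) (subst (0 <_) (sym (∑-δ²-realise (i , j))) pos)
  ... | l , hit = l , δ²-pos⇒≡ (realise l) (i , j) hit

  realise-positive : ∀ l → 0 < M (proj₁ (realise l)) (proj₂ (realise l))
  realise-positive l = begin-strict
    0                                        <⟨ ℕ.z<s ⟩
    1                                        ≡⟨ δ²-refl (realise l) ⟨
    δ² (realise l) (realise l)               ≤⟨ ∑-term (λ l′ → δ² (realise l′) (realise l)) l ⟩
    ∑[ l′ < k ] δ² (realise l′) (realise l)  ≡⟨ ∑-δ²-realise (realise l) ⟩
    M (proj₁ (realise l)) (proj₂ (realise l)) ∎
    where open ℕ.≤-Reasoning

∈-─⇒∉ : ∀ {n} {x : Fin n} (p q : Subset n) → x ∈ p ─ q → x ∉ q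
∈-─⇒∉ (_ ∷ p) (inside ∷ q) () here
∈-─⇒∉ (_ ∷ p) (_      ∷ q) (there x∈p─q) (there x∈q) = ∈-─⇒∉ p q x∈p─q x∈q

module _ {n} (d : Fin n → Fin n → ℚ) where

  ∈-ball⁻ : ∀ {ρ j x} → x ∈ ball d ρ j → d j x ℚ.≤ ρ
  ∈-ball⁻ {ρ} {j} {x} x∈ball =
    ℚ.≤ᵇ⇒≤ (Equivalence.from T-≡ (trans (sym (Vec.lookup∘tabulate (λ y → d j y ≤ᵇ ρ) x)) (Vec.[]=⇒lookup x∈ball)))

  ∈-ball⁺ : ∀ {ρ j x} → d j x ℚ.≤ ρ → x ∈ ball d ρ j
  ∈-ball⁺ {ρ} {j} {x} djx≤ρ =
    Vec.lookup⇒[]= x _ (trans (Vec.lookup∘tabulate (λ y → d j y ≤ᵇ ρ) x) (Equivalence.to T-≡ (ℚ.≤⇒≤ᵇ djx≤ρ)))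

  module _ {R : ℚ} where

    greedy-centre∈ : ∀ {rem cs} → Greedy d R rem cs → ∀ u → lookup cs u ∈ rem
    greedy-centre∈ (pick c∈rem _) zero = c∈rem
    greedy-centre∈ (pick {rem} {c} _ g) (suc u) = p─q⊆p rem (ball d (R ℚ.+ R) c) (greedy-centre∈ g u)

    greedy-covers : ∀ {rem cs} → Greedy d R rem cs → ∀ {j} → j ∈ rem → ∃ λ u → d (lookup cs u) j ℚ.≤ R ℚ.+ R
    greedy-covers (done empty) {j} j∈rem = ⊥-elim (empty (j , j∈rem))
    greedy-covers (pick {rem} {c} _ g) {j} j∈rem with d c j ℚ.≤? (R ℚ.+ R)
    ... | yes dcj≤2R = zero , dcj≤2R
    ... | no  dcj≰2R with greedy-covers g (x∈p∧x∉q⇒x∈p─q j∈rem (dcj≰2R ∘ ∈-ball⁻))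
    ...   | u , close = suc u , close

    greedy-separated : IsMetric d → ∀ {rem cs} → Greedy d R rem cs →
                       ∀ {u v} → u ≢ v → ¬ d (lookup cs u) (lookup cs v) ℚ.≤ R ℚ.+ R
    greedy-separated _ (pick _ g) {zero}  {zero}  u≢v _ = u≢v refl
    greedy-separated _ (pick {rem} {c} _ g) {zero}  {suc v} _ close =
      ∈-─⇒∉ rem (ball d (R ℚ.+ R) c) (greedy-centre∈ g v) (∈-ball⁺ close)
    greedy-separated metric (pick {rem} {c} _ g) {suc u} {zero}  _ close =
      ∈-─⇒∉ rem (ball d (R ℚ.+ R) c) (greedy-centre∈ g u)
        (∈-ball⁺ (subst (ℚ._≤ R ℚ.+ R) (IsMetric.symm metric _ c) close))
    greedy-separated metric (pick _ g) {suc u} {suc v} u≢v =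
      greedy-separated metric g (u≢v ∘ cong suc)

module NetworkFlows {n} (d : Fin n → Fin n → ℚ) (F₁ F₂ : Subset n) (B R : ℚ) (k : ℕ)
                    (cs₁ cs₂ : List (Fin n)) where

  open Network d F₁ F₂ B R k cs₁ cs₂

  m₁ m₂ : ℕ
  m₁ = length cs₁
  m₂ = length cs₂

  Withinℕ : Cap d → ℕ → Set
  Withinℕ none x = x ≡ 0
  Withinℕ one  x = x ≤ 1
  Withinℕ ∞    x = ⊤

  Withinℕ⇒Within : ∀ c {x} → Withinℕ c x → Within c (ℕtoℚ x)
  Withinℕ⇒Within none refl = refl
  Withinℕ⇒Within one  x≤1  = ℕtoℚ-mono-≤ x≤1
  Withinℕ⇒Within ∞    _    = tt

  Within⇒Withinℕ : ∀ c {x} → Within c (ℕtoℚ x) → Withinℕ c x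
  Within⇒Withinℕ none x≡0 = ℕtoℚ-injective x≡0
  Within⇒Withinℕ one  x≤1 = ℕtoℚ-cancel-≤ x≤1
  Within⇒Withinℕ ∞    _   = tt

  arcIf-open : ∀ {b} c {x} → Withinℕ (arcIf b c) x → 0 < x → T b
  arcIf-open {true}  _ _    _  = tt
  arcIf-open {false} _ refl ()

  δ-fits : ∀ {b} (x y : Fin n) → (x ≡ y → T b) → Withinℕ (arcIf b one) (δ x y)
  δ-fits {true}  x y _ = δ-≤1 x y
  δ-fits {false} x y opens with x ≟ y
  ... | yes x≡y = ⊥-elim (opens x≡y)
  ... | no _    = refl

  ∞-fits : ∀ {b} x → (0 < x → T b) → Withinℕ (arcIf b ∞) x
  ∞-fits {true}  _       _     = tt
  ∞-fits {false} zero    _     = refl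
  ∞-fits {false} (suc x) opens = ⊥-elim (opens (s≤s z≤n))

  sumV : (Vtx → ℕ) → ℕ
  sumV h = sum (map h allV)

  inℕ outℕ : (Vtx → Vtx → ℕ) → Vtx → ℕ
  inℕ  g v = sumV (λ u → g u v)
  outℕ g v = sumV (λ w → g v w)

  private
    sum-map-layer : ∀ {m} (layer : Fin m → Vtx) (h : Vtx → ℕ) →
                    sum (map h (map layer (allFin m))) ≡ ∑[ x < m ] h (layer x)
    sum-map-layer {m} layer h =
      trans (cong sum (sym (List.map-∘ {g = h} {f = layer} (allFin m)))) (sum-map-allFin (h ∘ layer))

    sum-map-layer-++ : ∀ {m} (layer : Fin m → Vtx) (h : Vtx → ℕ) vs →
                       sum (map h (map layer (allFin m) ++ vs)) ≡ ∑[ x < m ] h (layer x) + sum (map h vs)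
    sum-map-layer-++ layer h vs = begin
      sum (map h (map layer (allFin _) ++ vs))            ≡⟨ cong sum (List.map-++ h (map layer (allFin _)) vs) ⟩
      sum (map h (map layer (allFin _)) ++ map h vs)      ≡⟨ sum-++ (map h (map layer (allFin _))) (map h vs) ⟩
      sum (map h (map layer (allFin _))) + sum (map h vs) ≡⟨ cong (_+ sum (map h vs)) (sum-map-layer layer h) ⟩
      ∑[ x < _ ] h (layer x) + sum (map h vs)             ∎
      where open ≡-Reasoning

  sumV-layers : ∀ (h : Vtx → ℕ) {a b c₁ c₂ c₃ c₄ c₅ c₆} →
    h src ≡ a → h snk ≡ b →
    ∑[ x < m₁ ] h (cl₁ x) ≡ c₁ → ∑[ x < k ∸ m₁ ] h (dm₁ x) ≡ c₂ →
    ∑[ x < n ] h (fa₁ x) ≡ c₃ → ∑[ x < n ] h (fa₂ x) ≡ c₄ →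
    ∑[ x < m₂ ] h (cl₂ x) ≡ c₅ → ∑[ x < k ∸ m₂ ] h (dm₂ x) ≡ c₆ →
    sumV h ≡ a + (b + (c₁ + (c₂ + (c₃ + (c₄ + (c₅ + c₆))))))
  sumV-layers h refl refl refl refl refl refl refl refl =
    cong (λ z → h src + (h snk + z))
      (trans (sum-map-layer-++ cl₁ h _) (cong (_ +_)
      (trans (sum-map-layer-++ dm₁ h _) (cong (_ +_)
      (trans (sum-map-layer-++ fa₁ h _) (cong (_ +_)
      (trans (sum-map-layer-++ fa₂ h _) (cong (_ +_)
      (trans (sum-map-layer-++ cl₂ h _) (cong (_ +_)
      (sum-map-layer dm₂ h)))))))))))

  FitsCapacities : (Vtx → Vtx → ℕ) → Set
  FitsCapacities g = ∀ u v → Withinℕ (cap u v) (g u v)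

  Conserves : (Vtx → Vtx → ℕ) → Set
  Conserves g = ∀ v → v ≢ src → v ≢ snk → inℕ g v ≡ outℕ g v

  -- Every layer that cannot contain a neighbour of the vertex contributes 0, as `fits` forces flow 0
  -- on pairs without an arc.
  module Layers {g : Vtx → Vtx → ℕ} (fits : FitsCapacities g) where

    in-src : inℕ g src ≡ 0
    in-src = sumV-layers (λ w → g w src)
      (fits src src) (fits snk src)
      (∑-zero λ x → fits (cl₁ x) src) (∑-zero λ x → fits (dm₁ x) src) (∑-zero λ x → fits (fa₁ x) src)
      (∑-zero λ x → fits (fa₂ x) src) (∑-zero λ x → fits (cl₂ x) src) (∑-zero λ x → fits (dm₂ x) src)

    out-src : outℕ g src ≡ ∑[ u < m₁ ] g src (cl₁ u) + ∑[ a < k ∸ m₁ ] g src (dm₁ a)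
    out-src = trans (sumV-layers (g src)
      (fits src src) (fits src snk)
      refl refl (∑-zero λ x → fits src (fa₁ x))
      (∑-zero λ x → fits src (fa₂ x)) (∑-zero λ x → fits src (cl₂ x)) (∑-zero λ x → fits src (dm₂ x)))
      (cong (∑[ u < m₁ ] g src (cl₁ u) +_) (ℕ.+-identityʳ _))

    in-cl₁ : ∀ u → inℕ g (cl₁ u) ≡ g src (cl₁ u)
    in-cl₁ u = trans (sumV-layers (λ w → g w (cl₁ u))
      refl (fits snk (cl₁ u))
      (∑-zero λ x → fits (cl₁ x) (cl₁ u)) (∑-zero λ x → fits (dm₁ x) (cl₁ u)) (∑-zero λ x → fits (fa₁ x) (cl₁ u))
      (∑-zero λ x → fits (fa₂ x) (cl₁ u)) (∑-zero λ x → fits (cl₂ x) (cl₁ u)) (∑-zero λ x → fits (dm₂ x) (cl₁ u)))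
      (ℕ.+-identityʳ _)

    out-cl₁ : ∀ u → outℕ g (cl₁ u) ≡ ∑[ i < n ] g (cl₁ u) (fa₁ i)
    out-cl₁ u = trans (sumV-layers (g (cl₁ u))
      (fits (cl₁ u) src) (fits (cl₁ u) snk)
      (∑-zero λ x → fits (cl₁ u) (cl₁ x)) (∑-zero λ x → fits (cl₁ u) (dm₁ x)) refl
      (∑-zero λ x → fits (cl₁ u) (fa₂ x)) (∑-zero λ x → fits (cl₁ u) (cl₂ x)) (∑-zero λ x → fits (cl₁ u) (dm₂ x)))
      (ℕ.+-identityʳ _)

    in-dm₁ : ∀ a → inℕ g (dm₁ a) ≡ g src (dm₁ a)
    in-dm₁ a = trans (sumV-layers (λ w → g w (dm₁ a))
      refl (fits snk (dm₁ a))
      (∑-zero λ x → fits (cl₁ x) (dm₁ a)) (∑-zero λ x → fits (dm₁ x) (dm₁ a)) (∑-zero λ x → fits (fa₁ x) (dm₁ a))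
      (∑-zero λ x → fits (fa₂ x) (dm₁ a)) (∑-zero λ x → fits (cl₂ x) (dm₁ a)) (∑-zero λ x → fits (dm₂ x) (dm₁ a)))
      (ℕ.+-identityʳ _)

    out-dm₁ : ∀ a → outℕ g (dm₁ a) ≡ ∑[ i < n ] g (dm₁ a) (fa₁ i)
    out-dm₁ a = trans (sumV-layers (g (dm₁ a))
      (fits (dm₁ a) src) (fits (dm₁ a) snk)
      (∑-zero λ x → fits (dm₁ a) (cl₁ x)) (∑-zero λ x → fits (dm₁ a) (dm₁ x)) refl
      (∑-zero λ x → fits (dm₁ a) (fa₂ x)) (∑-zero λ x → fits (dm₁ a) (cl₂ x)) (∑-zero λ x → fits (dm₁ a) (dm₂ x)))
      (ℕ.+-identityʳ _)

    in-fa₁ : ∀ i → inℕ g (fa₁ i) ≡ ∑[ u < m₁ ] g (cl₁ u) (fa₁ i) + ∑[ a < k ∸ m₁ ] g (dm₁ a) (fa₁ i)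
    in-fa₁ i = trans (sumV-layers (λ w → g w (fa₁ i))
      (fits src (fa₁ i)) (fits snk (fa₁ i))
      refl refl (∑-zero λ x → fits (fa₁ x) (fa₁ i))
      (∑-zero λ x → fits (fa₂ x) (fa₁ i)) (∑-zero λ x → fits (cl₂ x) (fa₁ i)) (∑-zero λ x → fits (dm₂ x) (fa₁ i)))
      (cong (∑[ u < m₁ ] g (cl₁ u) (fa₁ i) +_) (ℕ.+-identityʳ _))

    out-fa₁ : ∀ i → outℕ g (fa₁ i) ≡ ∑[ j < n ] g (fa₁ i) (fa₂ j)
    out-fa₁ i = trans (sumV-layers (g (fa₁ i))
      (fits (fa₁ i) src) (fits (fa₁ i) snk)
      (∑-zero λ x → fits (fa₁ i) (cl₁ x)) (∑-zero λ x → fits (fa₁ i) (dm₁ x)) (∑-zero λ x → fits (fa₁ i) (fa₁ x))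
      refl (∑-zero λ x → fits (fa₁ i) (cl₂ x)) (∑-zero λ x → fits (fa₁ i) (dm₂ x)))
      (ℕ.+-identityʳ _)

    in-fa₂ : ∀ j → inℕ g (fa₂ j) ≡ ∑[ i < n ] g (fa₁ i) (fa₂ j)
    in-fa₂ j = trans (sumV-layers (λ w → g w (fa₂ j))
      (fits src (fa₂ j)) (fits snk (fa₂ j))
      (∑-zero λ x → fits (cl₁ x) (fa₂ j)) (∑-zero λ x → fits (dm₁ x) (fa₂ j)) refl
      (∑-zero λ x → fits (fa₂ x) (fa₂ j)) (∑-zero λ x → fits (cl₂ x) (fa₂ j)) (∑-zero λ x → fits (dm₂ x) (fa₂ j)))
      (ℕ.+-identityʳ _)

    out-fa₂ : ∀ j → outℕ g (fa₂ j) ≡ ∑[ u < m₂ ] g (fa₂ j) (cl₂ u) + ∑[ a < k ∸ m₂ ] g (fa₂ j) (dm₂ a)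
    out-fa₂ j = sumV-layers (g (fa₂ j))
      (fits (fa₂ j) src) (fits (fa₂ j) snk)
      (∑-zero λ x → fits (fa₂ j) (cl₁ x)) (∑-zero λ x → fits (fa₂ j) (dm₁ x)) (∑-zero λ x → fits (fa₂ j) (fa₁ x))
      (∑-zero λ x → fits (fa₂ j) (fa₂ x)) refl refl

    in-cl₂ : ∀ u → inℕ g (cl₂ u) ≡ ∑[ j < n ] g (fa₂ j) (cl₂ u)
    in-cl₂ u = trans (sumV-layers (λ w → g w (cl₂ u))
      (fits src (cl₂ u)) (fits snk (cl₂ u))
      (∑-zero λ x → fits (cl₁ x) (cl₂ u)) (∑-zero λ x → fits (dm₁ x) (cl₂ u)) (∑-zero λ x → fits (fa₁ x) (cl₂ u))
      refl (∑-zero λ x → fits (cl₂ x) (cl₂ u)) (∑-zero λ x → fits (dm₂ x) (cl₂ u)))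
      (ℕ.+-identityʳ _)

    out-cl₂ : ∀ u → outℕ g (cl₂ u) ≡ g (cl₂ u) snk
    out-cl₂ u = trans (sumV-layers (g (cl₂ u))
      (fits (cl₂ u) src) refl
      (∑-zero λ x → fits (cl₂ u) (cl₁ x)) (∑-zero λ x → fits (cl₂ u) (dm₁ x)) (∑-zero λ x → fits (cl₂ u) (fa₁ x))
      (∑-zero λ x → fits (cl₂ u) (fa₂ x)) (∑-zero λ x → fits (cl₂ u) (cl₂ x)) (∑-zero λ x → fits (cl₂ u) (dm₂ x)))
      (ℕ.+-identityʳ _)

    in-dm₂ : ∀ a → inℕ g (dm₂ a) ≡ ∑[ j < n ] g (fa₂ j) (dm₂ a)
    in-dm₂ a = trans (sumV-layers (λ w → g w (dm₂ a))
      (fits src (dm₂ a)) (fits snk (dm₂ a))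
      (∑-zero λ x → fits (cl₁ x) (dm₂ a)) (∑-zero λ x → fits (dm₁ x) (dm₂ a)) (∑-zero λ x → fits (fa₁ x) (dm₂ a))
      refl (∑-zero λ x → fits (cl₂ x) (dm₂ a)) (∑-zero λ x → fits (dm₂ x) (dm₂ a)))
      (ℕ.+-identityʳ _)

    out-dm₂ : ∀ a → outℕ g (dm₂ a) ≡ g (dm₂ a) snk
    out-dm₂ a = trans (sumV-layers (g (dm₂ a))
      (fits (dm₂ a) src) refl
      (∑-zero λ x → fits (dm₂ a) (cl₁ x)) (∑-zero λ x → fits (dm₂ a) (dm₁ x)) (∑-zero λ x → fits (dm₂ a) (fa₁ x))
      (∑-zero λ x → fits (dm₂ a) (fa₂ x)) (∑-zero λ x → fits (dm₂ a) (cl₂ x)) (∑-zero λ x → fits (dm₂ a) (dm₂ x)))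
      (ℕ.+-identityʳ _)

    in-snk : inℕ g snk ≡ ∑[ u < m₂ ] g (cl₂ u) snk + ∑[ a < k ∸ m₂ ] g (dm₂ a) snk
    in-snk = sumV-layers (λ w → g w snk)
      (fits src snk) (fits snk snk)
      (∑-zero λ x → fits (cl₁ x) snk) (∑-zero λ x → fits (dm₁ x) snk) (∑-zero λ x → fits (fa₁ x) snk)
      (∑-zero λ x → fits (fa₂ x) snk) refl refl

  module Cuts {g : Vtx → Vtx → ℕ} (fits : FitsCapacities g) (conserves : Conserves g) where
    open Layers fits

    passes-cl₁ : ∀ u → g src (cl₁ u) ≡ ∑[ i < n ] g (cl₁ u) (fa₁ i)
    passes-cl₁ u = trans (sym (in-cl₁ u)) (trans (conserves (cl₁ u) (λ ()) (λ ())) (out-cl₁ u))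

    passes-dm₁ : ∀ a → g src (dm₁ a) ≡ ∑[ i < n ] g (dm₁ a) (fa₁ i)
    passes-dm₁ a = trans (sym (in-dm₁ a)) (trans (conserves (dm₁ a) (λ ()) (λ ())) (out-dm₁ a))

    passes-fa₁ : ∀ i → ∑[ u < m₁ ] g (cl₁ u) (fa₁ i) + ∑[ a < k ∸ m₁ ] g (dm₁ a) (fa₁ i) ≡ ∑[ j < n ] g (fa₁ i) (fa₂ j)
    passes-fa₁ i = trans (sym (in-fa₁ i)) (trans (conserves (fa₁ i) (λ ()) (λ ())) (out-fa₁ i))

    passes-fa₂ : ∀ j → ∑[ i < n ] g (fa₁ i) (fa₂ j) ≡ ∑[ u < m₂ ] g (fa₂ j) (cl₂ u) + ∑[ a < k ∸ m₂ ] g (fa₂ j) (dm₂ a)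
    passes-fa₂ j = trans (sym (in-fa₂ j)) (trans (conserves (fa₂ j) (λ ()) (λ ())) (out-fa₂ j))

    passes-cl₂ : ∀ u → ∑[ j < n ] g (fa₂ j) (cl₂ u) ≡ g (cl₂ u) snk
    passes-cl₂ u = trans (sym (in-cl₂ u)) (trans (conserves (cl₂ u) (λ ()) (λ ())) (out-cl₂ u))

    passes-dm₂ : ∀ a → ∑[ j < n ] g (fa₂ j) (dm₂ a) ≡ g (dm₂ a) snk
    passes-dm₂ a = trans (sym (in-dm₂ a)) (trans (conserves (dm₂ a) (λ ()) (λ ())) (out-dm₂ a))

    source-cut : outℕ g src ≡ ∑[ i < n ] ∑[ j < n ] g (fa₁ i) (fa₂ j)
    source-cut = begin
      outℕ g src
        ≡⟨ out-src ⟩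
      ∑[ u < m₁ ] g src (cl₁ u) + ∑[ a < k ∸ m₁ ] g src (dm₁ a)
        ≡⟨ cong₂ _+_ (sum-cong-≗ passes-cl₁) (sum-cong-≗ passes-dm₁) ⟩
      ∑[ u < m₁ ] ∑[ i < n ] g (cl₁ u) (fa₁ i) + ∑[ a < k ∸ m₁ ] ∑[ i < n ] g (dm₁ a) (fa₁ i)
        ≡⟨ cong₂ _+_ (∑-comm (λ u i → g (cl₁ u) (fa₁ i))) (∑-comm (λ a i → g (dm₁ a) (fa₁ i))) ⟩
      ∑[ i < n ] ∑[ u < m₁ ] g (cl₁ u) (fa₁ i) + ∑[ i < n ] ∑[ a < k ∸ m₁ ] g (dm₁ a) (fa₁ i)
        ≡⟨ ∑-distrib-+ (λ i → ∑[ u < m₁ ] g (cl₁ u) (fa₁ i)) (λ i → ∑[ a < k ∸ m₁ ] g (dm₁ a) (fa₁ i)) ⟨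
      ∑[ i < n ] (∑[ u < m₁ ] g (cl₁ u) (fa₁ i) + ∑[ a < k ∸ m₁ ] g (dm₁ a) (fa₁ i))
        ≡⟨ sum-cong-≗ passes-fa₁ ⟩
      ∑[ i < n ] ∑[ j < n ] g (fa₁ i) (fa₂ j) ∎
      where open ≡-Reasoning

    sink-cut : ∑[ i < n ] ∑[ j < n ] g (fa₁ i) (fa₂ j) ≡ inℕ g snk
    sink-cut = begin
      ∑[ i < n ] ∑[ j < n ] g (fa₁ i) (fa₂ j)
        ≡⟨ ∑-comm (λ i j → g (fa₁ i) (fa₂ j)) ⟩
      ∑[ j < n ] ∑[ i < n ] g (fa₁ i) (fa₂ j)
        ≡⟨ sum-cong-≗ passes-fa₂ ⟩
      ∑[ j < n ] (∑[ u < m₂ ] g (fa₂ j) (cl₂ u) + ∑[ a < k ∸ m₂ ] g (fa₂ j) (dm₂ a))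
        ≡⟨ ∑-distrib-+ (λ j → ∑[ u < m₂ ] g (fa₂ j) (cl₂ u)) (λ j → ∑[ a < k ∸ m₂ ] g (fa₂ j) (dm₂ a)) ⟩
      ∑[ j < n ] ∑[ u < m₂ ] g (fa₂ j) (cl₂ u) + ∑[ j < n ] ∑[ a < k ∸ m₂ ] g (fa₂ j) (dm₂ a)
        ≡⟨ cong₂ _+_ (∑-comm (λ j u → g (fa₂ j) (cl₂ u))) (∑-comm (λ j a → g (fa₂ j) (dm₂ a))) ⟩
      ∑[ u < m₂ ] ∑[ j < n ] g (fa₂ j) (cl₂ u) + ∑[ a < k ∸ m₂ ] ∑[ j < n ] g (fa₂ j) (dm₂ a)
        ≡⟨ cong₂ _+_ (sum-cong-≗ passes-cl₂) (sum-cong-≗ passes-dm₂) ⟩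
      ∑[ u < m₂ ] g (cl₂ u) snk + ∑[ a < k ∸ m₂ ] g (dm₂ a) snk
        ≡⟨ in-snk ⟨
      inℕ g snk ∎
      where open ≡-Reasoning

  module Transfer {f : Vtx → Vtx → ℚ} {g : Vtx → Vtx → ℕ} (f≡g : ∀ u v → f u v ≡ ℕtoℚ (g u v)) where

    inflow-ℕtoℚ : ∀ v → inflow f v ≡ ℕtoℚ (inℕ g v)
    inflow-ℕtoℚ v = trans (cong sumℚ (List.map-cong (λ u → f≡g u v) allV)) (sumℚ-map-ℕtoℚ (λ u → g u v) allV)

    outflow-ℕtoℚ : ∀ v → outflow f v ≡ ℕtoℚ (outℕ g v)
    outflow-ℕtoℚ v = trans (cong sumℚ (List.map-cong (f≡g v) allV)) (sumℚ-map-ℕtoℚ (g v) allV)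

    IsFlow⇒fits×conserves : IsFlow f → FitsCapacities g × Conserves g
    IsFlow⇒fits×conserves flow = fits , conserves
      where
      open IsFlow flow
      fits : FitsCapacities g
      fits u v = Within⇒Withinℕ (cap u v) (subst (Within (cap u v)) (f≡g u v) (capacity u v))
      conserves : Conserves g
      conserves v ≢src ≢snk =
        ℕtoℚ-injective (trans (sym (inflow-ℕtoℚ v)) (trans (conservation v ≢src ≢snk) (outflow-ℕtoℚ v)))

    fits×conserves⇒IsFlow : FitsCapacities g → Conserves g → IsFlow f
    fits×conserves⇒IsFlow fits conserves = record
      { nonneg       = λ u v → subst (0ℚ ℚ.≤_) (sym (f≡g u v)) (ℕtoℚ-mono-≤ {b = g u v} z≤n)
      ; capacity     = λ u v → subst (Within (cap u v)) (sym (f≡g u v)) (Withinℕ⇒Within (cap u v) (fits u v))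
      ; conservation = λ v ≢src ≢snk →
          trans (inflow-ℕtoℚ v) (trans (cong ℕtoℚ (conserves v ≢src ≢snk)) (sym (outflow-ℕtoℚ v)))
      }

    value-ℕtoℚ : FitsCapacities g → value f ≡ ℕtoℚ (outℕ g src)
    value-ℕtoℚ fits = begin
      outflow f src ℚ.- inflow f src
        ≡⟨ cong₂ ℚ._-_ (outflow-ℕtoℚ src) (trans (inflow-ℕtoℚ src) (cong ℕtoℚ (Layers.in-src fits))) ⟩
      ℕtoℚ (outℕ g src) ℚ.- 0ℚ
        ≡⟨ ℚ.+-identityʳ (ℕtoℚ (outℕ g src)) ⟩
      ℕtoℚ (outℕ g src) ∎
      where open ≡-Reasoning

module _ {n} {d : Fin n → Fin n → ℚ} (metric : IsMetric d) where
  open IsMetric metric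

  dist-≤-+ : ∀ {x y z a b} → d x y ℚ.≤ a → d y z ℚ.≤ b → d x z ℚ.≤ a ℚ.+ b
  dist-≤-+ {x} {y} {z} dxy≤a dyz≤b = ℚ.≤-trans (triangle x y z) (ℚ.+-mono-≤ dxy≤a dyz≤b)

  module ServingPairs {k R} {C : Subset n} {cs} (greedy : Greedy d R C cs)
                      (A : Fin k → Fin n) (served : ∀ j → j ∈ C → ∃ λ l → d j (A l) ℚ.≤ R) where

    servingPair : Fin (length cs) → Fin k
    servingPair u = proj₁ (served (lookup cs u) (greedy-centre∈ d greedy u))

    servingPair-close : ∀ u → d (lookup cs u) (A (servingPair u)) ℚ.≤ R
    servingPair-close u = proj₂ (served (lookup cs u) (greedy-centre∈ d greedy u))

    servingPair-injective : Injective _≡_ _≡_ servingPair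
    servingPair-injective {u} {v} same with u ≟ v
    ... | yes u≡v = u≡v
    ... | no  u≢v = ⊥-elim (greedy-separated d metric greedy u≢v
                      (dist-≤-+ (servingPair-close u)
                        (subst (λ l → d (A l) (lookup cs v) ℚ.≤ R) (sym same)
                          (subst (ℚ._≤ R) (symm _ _) (servingPair-close v)))))

    length≤k : length cs ≤ k
    length≤k = injective⇒≤ servingPair-injective

    unservedPair : Fin (k ∸ length cs) → Fin k
    unservedPair = complement servingPair servingPair-injective

module Instance {n} {d : Fin n → Fin n → ℚ} (metric : IsMetric d)
  {C₁ C₂ F₁ F₂ : Subset n} {B : ℚ} {k : ℕ} {R : ℚ} (optimal : OptimalValue d C₁ C₂ F₁ F₂ B k R)
  {cs₁ cs₂ : List (Fin n)} (greedy₁ : Greedy d R C₁ cs₁) (greedy₂ : Greedy d R C₂ cs₂) where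

  open IsMetric metric
  open Network d F₁ F₂ B R k cs₁ cs₂
  open NetworkFlows d F₁ F₂ B R k cs₁ cs₂

  sol* : Solution n k
  sol* = proj₁ (proj₁ optimal)

  feasible* : Feasible d F₁ F₂ B sol*
  feasible* = proj₁ (proj₂ (proj₁ optimal))

  R≥0 : 0ℚ ℚ.≤ R
  R≥0 = proj₁ (proj₂ (proj₂ (proj₁ optimal)))

  open ServingPairs metric greedy₁ (proj₁ ∘ sol*) (proj₁ (proj₂ (proj₂ (proj₂ (proj₁ optimal)))))
    renaming ( servingPair to φ₁; servingPair-close to φ₁-close; servingPair-injective to φ₁-injective
             ; length≤k to m₁≤k; unservedPair to ρ₁)
  open ServingPairs metric greedy₂ (proj₂ ∘ sol*) (proj₂ (proj₂ (proj₂ (proj₂ (proj₁ optimal)))))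
    renaming ( servingPair to φ₂; servingPair-close to φ₂-close; servingPair-injective to φ₂-injective
             ; length≤k to m₂≤k; unservedPair to ρ₂)

  module FromOptimum where

    i₁ i₂ : Fin k → Fin n
    i₁ = proj₁ ∘ sol*
    i₂ = proj₂ ∘ sol*

    ∈F₁ : ∀ l → T (inF₁ (i₁ l))
    ∈F₁ l = T-does⁺ (i₁ l ∈? F₁) (proj₁ (feasible* l))

    ∈F₂ : ∀ l → T (inF₂ (i₂ l))
    ∈F₂ l = T-does⁺ (i₂ l ∈? F₂) (proj₁ (proj₂ (feasible* l)))

    -- Optimal pair l carries one unit s → c → i₁ l → i₂ l → c′ → t, where c (resp. c′) is the cluster
    -- whose centre l serves, or the dummy cluster matched with l if there is none.
    optimalFlow : Vtx → Vtx → ℕ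
    optimalFlow src     (cl₁ _) = 1
    optimalFlow src     (dm₁ _) = 1
    optimalFlow (cl₁ u) (fa₁ i) = δ (i₁ (φ₁ u)) i
    optimalFlow (dm₁ a) (fa₁ i) = δ (i₁ (ρ₁ a)) i
    optimalFlow (fa₁ i) (fa₂ j) = ∑[ l < k ] δ² (sol* l) (i , j)
    optimalFlow (fa₂ j) (cl₂ u) = δ (i₂ (φ₂ u)) j
    optimalFlow (fa₂ j) (dm₂ a) = δ (i₂ (ρ₂ a)) j
    optimalFlow (cl₂ _) snk     = 1
    optimalFlow (dm₂ _) snk     = 1
    optimalFlow _       _       = 0

    servingArc₁ : ∀ u → T (inF₁ (i₁ (φ₁ u)) ∧ (d (lookup cs₁ u) (i₁ (φ₁ u)) ≤ᵇ R))
    servingArc₁ u = Equivalence.from T-∧ (∈F₁ (φ₁ u) , ℚ.≤⇒≤ᵇ (φ₁-close u))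

    servingArc₂ : ∀ u → T (inF₂ (i₂ (φ₂ u)) ∧ (d (i₂ (φ₂ u)) (lookup cs₂ u) ≤ᵇ R))
    servingArc₂ u = Equivalence.from T-∧ (∈F₂ (φ₂ u) , ℚ.≤⇒≤ᵇ (subst (ℚ._≤ R) (symm _ _) (φ₂-close u)))

    pairArc : ∀ l → T (inF₁ (i₁ l) ∧ inF₂ (i₂ l) ∧ (d (i₁ l) (i₂ l) ≤ᵇ B))
    pairArc l =
      Equivalence.from T-∧ (∈F₁ l , Equivalence.from T-∧ (∈F₂ l , ℚ.≤⇒≤ᵇ (proj₂ (proj₂ (feasible* l)))))

    pairArc-open : ∀ i j → 0 < ∑[ l < k ] δ² (sol* l) (i , j) → T (inF₁ i ∧ inF₂ j ∧ (d i j ≤ᵇ B))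
    pairArc-open i j pos with ∑-pos (λ l → δ² (sol* l) (i , j)) pos
    ... | l , hit = subst (λ p → T (inF₁ (proj₁ p) ∧ inF₂ (proj₂ p) ∧ (d (proj₁ p) (proj₂ p) ≤ᵇ B)))
                          (δ²-pos⇒≡ (sol* l) (i , j) hit) (pairArc l)

    optimalFlow-fits : FitsCapacities optimalFlow
    optimalFlow-fits src     src     = refl
    optimalFlow-fits src     snk     = refl
    optimalFlow-fits src     (cl₁ _) = ℕ.≤-refl
    optimalFlow-fits src     (dm₁ _) = ℕ.≤-refl
    optimalFlow-fits src     (fa₁ _) = refl
    optimalFlow-fits src     (fa₂ _) = refl
    optimalFlow-fits src     (cl₂ _) = refl
    optimalFlow-fits src     (dm₂ _) = refl
    optimalFlow-fits snk     src     = refl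
    optimalFlow-fits snk     snk     = refl
    optimalFlow-fits snk     (cl₁ _) = refl
    optimalFlow-fits snk     (dm₁ _) = refl
    optimalFlow-fits snk     (fa₁ _) = refl
    optimalFlow-fits snk     (fa₂ _) = refl
    optimalFlow-fits snk     (cl₂ _) = refl
    optimalFlow-fits snk     (dm₂ _) = refl
    optimalFlow-fits (cl₁ _) src     = refl
    optimalFlow-fits (cl₁ _) snk     = refl
    optimalFlow-fits (cl₁ _) (cl₁ _) = refl
    optimalFlow-fits (cl₁ _) (dm₁ _) = refl
    optimalFlow-fits (cl₁ u) (fa₁ i) = δ-fits (i₁ (φ₁ u)) i λ { refl → servingArc₁ u }
    optimalFlow-fits (cl₁ _) (fa₂ _) = refl
    optimalFlow-fits (cl₁ _) (cl₂ _) = refl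
    optimalFlow-fits (cl₁ _) (dm₂ _) = refl
    optimalFlow-fits (dm₁ _) src     = refl
    optimalFlow-fits (dm₁ _) snk     = refl
    optimalFlow-fits (dm₁ _) (cl₁ _) = refl
    optimalFlow-fits (dm₁ _) (dm₁ _) = refl
    optimalFlow-fits (dm₁ a) (fa₁ i) = δ-fits (i₁ (ρ₁ a)) i λ { refl → ∈F₁ (ρ₁ a) }
    optimalFlow-fits (dm₁ _) (fa₂ _) = refl
    optimalFlow-fits (dm₁ _) (cl₂ _) = refl
    optimalFlow-fits (dm₁ _) (dm₂ _) = refl
    optimalFlow-fits (fa₁ _) src     = refl
    optimalFlow-fits (fa₁ _) snk     = refl
    optimalFlow-fits (fa₁ _) (cl₁ _) = refl
    optimalFlow-fits (fa₁ _) (dm₁ _) = refl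
    optimalFlow-fits (fa₁ _) (fa₁ _) = refl
    optimalFlow-fits (fa₁ i) (fa₂ j) = ∞-fits _ (pairArc-open i j)
    optimalFlow-fits (fa₁ _) (cl₂ _) = refl
    optimalFlow-fits (fa₁ _) (dm₂ _) = refl
    optimalFlow-fits (fa₂ _) src     = refl
    optimalFlow-fits (fa₂ _) snk     = refl
    optimalFlow-fits (fa₂ _) (cl₁ _) = refl
    optimalFlow-fits (fa₂ _) (dm₁ _) = refl
    optimalFlow-fits (fa₂ _) (fa₁ _) = refl
    optimalFlow-fits (fa₂ _) (fa₂ _) = refl
    optimalFlow-fits (fa₂ j) (cl₂ u) = δ-fits (i₂ (φ₂ u)) j λ { refl → servingArc₂ u }
    optimalFlow-fits (fa₂ j) (dm₂ a) = δ-fits (i₂ (ρ₂ a)) j λ { refl → ∈F₂ (ρ₂ a) }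
    optimalFlow-fits (cl₂ _) src     = refl
    optimalFlow-fits (cl₂ _) snk     = ℕ.≤-refl
    optimalFlow-fits (cl₂ _) (cl₁ _) = refl
    optimalFlow-fits (cl₂ _) (dm₁ _) = refl
    optimalFlow-fits (cl₂ _) (fa₁ _) = refl
    optimalFlow-fits (cl₂ _) (fa₂ _) = refl
    optimalFlow-fits (cl₂ _) (cl₂ _) = refl
    optimalFlow-fits (cl₂ _) (dm₂ _) = refl
    optimalFlow-fits (dm₂ _) src     = refl
    optimalFlow-fits (dm₂ _) snk     = ℕ.≤-refl
    optimalFlow-fits (dm₂ _) (cl₁ _) = refl
    optimalFlow-fits (dm₂ _) (dm₁ _) = refl
    optimalFlow-fits (dm₂ _) (fa₁ _) = refl
    optimalFlow-fits (dm₂ _) (fa₂ _) = refl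
    optimalFlow-fits (dm₂ _) (cl₂ _) = refl
    optimalFlow-fits (dm₂ _) (dm₂ _) = refl

    open Layers optimalFlow-fits

    optimalFlow-conserves : Conserves optimalFlow
    optimalFlow-conserves src     src≢src _ = ⊥-elim (src≢src refl)
    optimalFlow-conserves snk     _ snk≢snk = ⊥-elim (snk≢snk refl)
    optimalFlow-conserves (cl₁ u) _ _ = trans (in-cl₁ u) (sym (trans (out-cl₁ u) (∑-δ-one (i₁ (φ₁ u)))))
    optimalFlow-conserves (dm₁ a) _ _ = trans (in-dm₁ a) (sym (trans (out-dm₁ a) (∑-δ-one (i₁ (ρ₁ a)))))
    optimalFlow-conserves (fa₁ i) _ _ = begin
      inℕ optimalFlow (fa₁ i)                                        ≡⟨ in-fa₁ i ⟩
      ∑[ u < m₁ ] δ (i₁ (φ₁ u)) i + ∑[ a < k ∸ m₁ ] δ (i₁ (ρ₁ a)) i  ≡⟨ ∑-image+complement φ₁ φ₁-injective _ ⟩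
      ∑[ l < k ] δ (i₁ l) i                                          ≡⟨ marginal₁ sol* i ⟨
      ∑[ j < n ] ∑[ l < k ] δ² (sol* l) (i , j)                      ≡⟨ out-fa₁ i ⟨
      outℕ optimalFlow (fa₁ i)                                       ∎
      where open ≡-Reasoning
    optimalFlow-conserves (fa₂ j) _ _ = begin
      inℕ optimalFlow (fa₂ j)                                        ≡⟨ in-fa₂ j ⟩
      ∑[ i < n ] ∑[ l < k ] δ² (sol* l) (i , j)                      ≡⟨ marginal₂ sol* j ⟩
      ∑[ l < k ] δ (i₂ l) j                                          ≡⟨ ∑-image+complement φ₂ φ₂-injective _ ⟨
      ∑[ u < m₂ ] δ (i₂ (φ₂ u)) j + ∑[ a < k ∸ m₂ ] δ (i₂ (ρ₂ a)) j  ≡⟨ out-fa₂ j ⟨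
      outℕ optimalFlow (fa₂ j)                                       ∎
      where open ≡-Reasoning
    optimalFlow-conserves (cl₂ u) _ _ = trans (trans (in-cl₂ u) (∑-δ-one (i₂ (φ₂ u)))) (sym (out-cl₂ u))
    optimalFlow-conserves (dm₂ a) _ _ = trans (trans (in-dm₂ a) (∑-δ-one (i₂ (ρ₂ a)))) (sym (out-dm₂ a))

    optimalFlow-value : outℕ optimalFlow src ≡ k
    optimalFlow-value = begin
      outℕ optimalFlow src                          ≡⟨ out-src ⟩
      ∑[ u < m₁ ] 1 + ∑[ a < k ∸ m₁ ] 1            ≡⟨ cong₂ _+_ (∑-one m₁) (∑-one (k ∸ m₁)) ⟩
      m₁ + (k ∸ m₁)                               ≡⟨ ℕ.m+[n∸m]≡n m₁≤k ⟩
      k                                             ∎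
      where open ≡-Reasoning

    flowOfValue-k : ∃ λ f → IsFlow f × value f ≡ ℕtoℚ k
    flowOfValue-k = (λ u v → ℕtoℚ (optimalFlow u v)) , fits×conserves⇒IsFlow optimalFlow-fits optimalFlow-conserves ,
                    trans (value-ℕtoℚ optimalFlow-fits) (cong ℕtoℚ optimalFlow-value)
      where open Transfer {g = optimalFlow} (λ _ _ → refl)

  module FromIntegralFlow {g : Vtx → Vtx → ℕ} (fits : FitsCapacities g) (conserves : Conserves g)
                          (value-k : outℕ g src ≡ k) where
    open Layers fits
    open Cuts fits conserves

    M : Fin n → Fin n → ℕ
    M i j = g (fa₁ i) (fa₂ j)

    total : ∑[ i < n ] ∑[ j < n ] M i j ≡ k
    total = trans (sym source-cut) value-k

    source-saturated : ∀ u → g src (cl₁ u) ≡ 1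
    source-saturated = ∑-saturated (λ u → g src (cl₁ u)) (λ a → g src (dm₁ a))
      (λ u → fits src (cl₁ u)) (λ a → fits src (dm₁ a))
      (trans (sym out-src) (trans value-k (sym (ℕ.m+[n∸m]≡n m₁≤k))))

    sink-saturated : ∀ u → g (cl₂ u) snk ≡ 1
    sink-saturated = ∑-saturated (λ u → g (cl₂ u) snk) (λ a → g (dm₂ a) snk)
      (λ u → fits (cl₂ u) snk) (λ a → fits (dm₂ a) snk)
      (trans (sym in-snk) (trans (sym sink-cut) (trans total (sym (ℕ.m+[n∸m]≡n m₂≤k)))))

    served₁ : ∀ u → ∃ λ i → d (lookup cs₁ u) i ℚ.≤ R × ∃ λ j → 0 < M i j
    served₁ u = i , close , ∑-pos (M i) (subst (0 <_) (passes-fa₁ i) inflow-pos)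
      where
      out-pos = ∑-pos (λ i → g (cl₁ u) (fa₁ i)) (subst (0 <_) (trans (sym (source-saturated u)) (passes-cl₁ u)) ℕ.z<s)
      i = proj₁ out-pos
      close : d (lookup cs₁ u) i ℚ.≤ R
      close = ℚ.≤ᵇ⇒≤ (proj₂ (Equivalence.to T-∧ (arcIf-open one (fits (cl₁ u) (fa₁ i)) (proj₂ out-pos))))
      inflow-pos : 0 < ∑[ u′ < m₁ ] g (cl₁ u′) (fa₁ i) + ∑[ a < k ∸ m₁ ] g (dm₁ a) (fa₁ i)
      inflow-pos = ℕ.<-≤-trans (proj₂ out-pos) (ℕ.≤-trans (∑-term (λ u′ → g (cl₁ u′) (fa₁ i)) u) (ℕ.m≤m+n _ _))

    served₂ : ∀ u → ∃ λ j → d j (lookup cs₂ u) ℚ.≤ R × ∃ λ i → 0 < M i j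
    served₂ u = j , close , ∑-pos (λ i → M i j) (subst (0 <_) (sym (passes-fa₂ j)) outflow-pos)
      where
      in-pos = ∑-pos (λ j → g (fa₂ j) (cl₂ u)) (subst (0 <_) (trans (sym (sink-saturated u)) (sym (passes-cl₂ u))) ℕ.z<s)
      j = proj₁ in-pos
      close : d j (lookup cs₂ u) ℚ.≤ R
      close = ℚ.≤ᵇ⇒≤ (proj₂ (Equivalence.to T-∧ (arcIf-open one (fits (fa₂ j) (cl₂ u)) (proj₂ in-pos))))
      outflow-pos : 0 < ∑[ u′ < m₂ ] g (fa₂ j) (cl₂ u′) + ∑[ a < k ∸ m₂ ] g (fa₂ j) (dm₂ a)
      outflow-pos = ℕ.<-≤-trans (proj₂ in-pos) (ℕ.≤-trans (∑-term (λ u′ → g (fa₂ j) (cl₂ u′)) u) (ℕ.m≤m+n _ _))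

    sol : Solution n k
    sol = realise M total

    sol-feasible : Feasible d F₁ F₂ B sol
    sol-feasible l = T-does⁻ (i ∈? F₁) i∈ , T-does⁻ (j ∈? F₂) j∈ , ℚ.≤ᵇ⇒≤ dij≤B
      where
      i = proj₁ (sol l)
      j = proj₂ (sol l)
      arc = Equivalence.to T-∧ (arcIf-open ∞ (fits (fa₁ i) (fa₂ j)) (realise-positive M total l))
      i∈ = proj₁ arc
      j∈ = proj₁ (Equivalence.to T-∧ (proj₂ arc))
      dij≤B = proj₂ (Equivalence.to T-∧ (proj₂ arc))

    sol-cost : CostAtMost d C₁ C₂ sol (R ℚ.+ R ℚ.+ R)
    sol-cost = 3R≥0 , covers₁ , covers₂
      where
      3R≥0 : 0ℚ ℚ.≤ R ℚ.+ R ℚ.+ R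
      3R≥0 = subst (ℚ._≤ R ℚ.+ R ℚ.+ R) (trans (ℚ.+-identityʳ _) (ℚ.+-identityʳ _))
                   (ℚ.+-mono-≤ (ℚ.+-mono-≤ R≥0 R≥0) R≥0)
      covers₁ : ∀ x → x ∈ C₁ → ∃ λ l → d x (proj₁ (sol l)) ℚ.≤ R ℚ.+ R ℚ.+ R
      covers₁ x x∈C₁ with greedy-covers d greedy₁ x∈C₁
      ... | u , near with served₁ u
      ... | i , close , j , pos with realise-hits M total i j pos
      ... | l , sol-l = l , subst (λ y → d x y ℚ.≤ R ℚ.+ R ℚ.+ R) (sym (cong proj₁ sol-l))
                              (dist-≤-+ metric (subst (ℚ._≤ R ℚ.+ R) (symm _ _) near) close)
      covers₂ : ∀ x → x ∈ C₂ → ∃ λ l → d x (proj₂ (sol l)) ℚ.≤ R ℚ.+ R ℚ.+ R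
      covers₂ x x∈C₂ with greedy-covers d greedy₂ x∈C₂
      ... | u , near with served₂ u
      ... | j , close , i , pos with realise-hits M total i j pos
      ... | l , sol-l = l , subst (λ y → d x y ℚ.≤ R ℚ.+ R ℚ.+ R) (sym (cong proj₂ sol-l))
                              (dist-≤-+ metric (subst (ℚ._≤ R ℚ.+ R) (symm _ _) near) (subst (ℚ._≤ R) (symm _ _) close))

  solutionFromIntegralFlow : ∀ f → IsFlow f → Integral f → value f ≡ ℕtoℚ k →
    ∃ λ (sol : Solution n k) → Feasible d F₁ F₂ B sol × CostAtMost d C₁ C₂ sol (R ℚ.+ R ℚ.+ R) × ObtainedFrom f sol
  solutionFromIntegralFlow f flow integral value-f =
    sol , sol-feasible , sol-cost , λ i j → trans (f≡g (fa₁ i) (fa₂ j)) (cong ℕtoℚ (sym (countᵇ-realise M total i j)))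
    where
    g : Vtx → Vtx → ℕ
    g u v = proj₁ (integral u v)
    f≡g : ∀ u v → f u v ≡ ℕtoℚ (g u v)
    f≡g u v = proj₂ (integral u v)
    open Transfer {g = g} f≡g
    fits = proj₁ (IsFlow⇒fits×conserves flow)
    value-k : outℕ g src ≡ k
    value-k = ℕtoℚ-injective (trans (sym (value-ℕtoℚ fits)) value-f)
    open FromIntegralFlow fits (proj₂ (IsFlow⇒fits×conserves flow)) value-k

mainTheorem5 :
    ∀ {n : ℕ} (d : Fin n → Fin n → ℚ) → IsMetric d →
    (C₁ C₂ F₁ F₂ : Subset n) (B : ℚ) → 0ℚ ℚ.< B → (k : ℕ) → 1 ≤ k →
    (R : ℚ) → OptimalValue d C₁ C₂ F₁ F₂ B k R →
    (cs₁ cs₂ : List (Fin n)) → Greedy d R C₁ cs₁ → Greedy d R C₂ cs₂ →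
    let open Network d F₁ F₂ B R k cs₁ cs₂ in
    (∃ λ f → IsFlow f × value f ≡ ℕtoℚ k)
    × (∀ f → IsFlow f → Integral f → value f ≡ ℕtoℚ k →
         ∃ λ (sol : Solution n k) →
           Feasible d F₁ F₂ B sol × CostAtMost d C₁ C₂ sol (R ℚ.+ R ℚ.+ R) × ObtainedFrom f sol)
mainTheorem5 d metric C₁ C₂ F₁ F₂ B _ k _ R optimal cs₁ cs₂ greedy₁ greedy₂ =
  FromOptimum.flowOfValue-k , solutionFromIntegralFlow
  where open Instance metric optimal greedy₁ greedy₂
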